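{- Let $n,\delta\in\mathbb{N}$ with $\delta\ge3$. If $G$ is a connected $C_4$-free graph of order $n$ and minimum degree $\delta$, then \[\rho(G)\le \frac52\left\lfloor\frac{n}{\delta^2-2\lfloor\delta/2\rfloor+1}\right\rfloor+2.\]
   Context: $C_4$-free means containing no 4-cycle as a subgraph. For a connected graph $G$ of order $n\ge2$ and vertex $v$, $\overline{\sigma}(v)=\frac{1}{n-1}\sum_{w}d(v,w)$; the remoteness is $\rho(G)=\max_v\overline{\sigma}(v)$. -}

module Defs where

open import Data.Nat as ℕ using (ℕ; zero; suc; _+_; _*_; _∸_; _≤_)
open import Data.Nat.DivMod using (_/_)
open import Data.Bool using (Bool; true; false; T; _∧_; _∨_; if_then_else_)
open import Data.Fin using (Fin)
open import Data.Fin.Properties using (_≟_)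
open import Data.List using (List; map; foldr; filter; length)
open import Data.Bool.ListAction using (any)
open import Data.Nat.ListAction using (sum)
open import Data.List.Base using (allFin)
open import Data.Product using (Σ; ∃; _×_; _,_)
open import Relation.Binary.PropositionalEquality using (_≡_; _≢_)
open import Relation.Nullary.Decidable using (⌊_⌋)
open import Data.Integer using (+_)
import Data.Rational as ℚ
open ℚ using (ℚ)

record Graph (n : ℕ) : Set where
  field
    adj   : Fin n → Fin n → Bool
    sym   : ∀ u v → adj u v ≡ adj v u
    loopless : ∀ v → adj v v ≡ false
open Graph public

module _ {n : ℕ} (G : Graph n) where

  deg : Fin n → ℕ
  deg v = length (filter (λ w → T? (adj G v w)) (allFin n))
    where
    open import Data.Bool.Properties using (T?)

  MinDegree : ℕ → Set
  MinDegree δ = (∀ v → δ ≤ deg v) × (∃ λ v → deg v ≡ δ)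

  reach : ℕ → Fin n → Fin n → Bool
  reach zero    u v = ⌊ u ≟ v ⌋
  reach (suc k) u v = reach k u v ∨ any (λ w → adj G u w ∧ reach k w v) (allFin n)

  data Walk : Fin n → Fin n → ℕ → Set where
    here : ∀ {v} → Walk v v zero
    step : ∀ {u w v k} → T (adj G u w) → Walk w v k → Walk u v (suc k)

  Connected : Set
  Connected = ∀ u v → ∃ λ k → Walk u v k

  C4Free : Set
  C4Free = ∀ a b c d → a ≢ b → a ≢ c → a ≢ d → b ≢ c → b ≢ d → c ≢ d →
           T (adj G a b) → T (adj G b c) → T (adj G c d) → T (adj G d a) → Data.Empty.⊥
    where import Data.Empty

  -- distance: least k with a walk of length ≤ k (search up to bound; a shortest
  -- walk in a connected graph on n vertices has length < n)
  distFrom : ℕ → ℕ → Fin n → Fin n → ℕ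
  distFrom k zero    u v = k
  distFrom k (suc f) u v = if reach k u v then k else distFrom (suc k) f u v

  dist : Fin n → Fin n → ℕ
  dist u v = distFrom 0 n u v

  σ : Fin n → ℕ
  σ v = sum (map (dist v) (allFin n))

-- s / (n - 1) as a rational (0 when n ≤ 1; never used then)
avg : ℕ → ℕ → ℚ
avg s zero = ℚ.0ℚ
avg s (suc zero) = ℚ.0ℚ
avg s (suc (suc m)) = (+ s) ℚ./ suc m

σ̄ : {n : ℕ} → Graph n → Fin n → ℚ
σ̄ {n} G v = avg (σ G v) n

-- remoteness ρ(G) = max over v of σ̄(v)  (all σ̄ are ≥ 0, so 0 is a neutral start)
ρ : {n : ℕ} → Graph n → ℚ
ρ {n} G = foldr ℚ._⊔_ ℚ.0ℚ (map (σ̄ G) (allFin n))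

bound : ℕ → ℕ → ℚ
bound n δ = (+ 5 ℚ./ 2) ℚ.* ((+ (n / suc (δ * δ ∸ 2 * (δ / 2)))) ℚ./ 1) ℚ.+ (+ 2 ℚ./ 1)

-- Fix a vertex v and let D = δ² − 2⌊δ/2⌋ + 1. Since two vertices of a C₄-free graph have at
-- most one common neighbour, counting the walks x–u–y shows that at least δ·deg x + 1 − e
-- vertices lie within distance 2 of any vertex x, where e (twice the number of edges inside
-- N(x)) is even and at most deg x; hence at least D of them. All these vertices have distance
-- from v within 2 of that of x, and by connectivity every distance up to the eccentricity of v
-- occurs, so every window of five consecutive distance levels around such a distance holds at
-- least D vertices. Windows five levels apart are disjoint, which bounds the eccentricity by
-- 5⌊n/D⌋ − 1 and the number of vertices beyond level 2 + 5j + r (r < 5) by n − (j + 1)D.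
-- Summing these tail counts gives σ(v) ≤ (n − 1)(5⌊n/D⌋ + 4)/2.
module Submission where

open import Defs
open import Data.Nat using (ℕ; _≤_)
open import Data.Rational using () renaming (_≤_ to _≤ℚ_)

open import Data.Nat
  using (zero; suc; _+_; _*_; _∸_; _<_; _⊓_; z≤n; s≤s; s≤s⁻¹; z<s; _<?_; _≤?_; _/_; _%_; NonZero)
open import Data.Nat.Properties hiding (_≟_; suc-injective)
open import Data.Nat.DivMod using (m≡m%n+[m/n]*n; m%n<n; m/n*n≤m; m*n/n≡m; /-monoˡ-≤; m≥n⇒m/n>0)
open import Data.Nat.ListAction using (sum)
open import Data.Nat.Tactic.RingSolver using (solve-∀)
open import Data.Fin using (Fin; zero; suc)
open import Data.Fin.Properties using (_≟_; suc-injective; toℕ<n)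
open import Data.Product using (∃; _×_; _,_; proj₁; proj₂; map₂)
open import Data.Sum using (_⊎_; inj₁; inj₂)
open import Data.Empty using (⊥-elim)
open import Data.Bool using (T; true; false)
open import Data.Bool.Properties using (T?; T-∨; T-∧)
open import Data.List using ([]; _∷_; allFin; tabulate; filter; length; map; foldr)
open import Data.List.Membership.Propositional using (lose)
open import Data.List.Membership.Propositional.Properties using (∈-allFin)
open import Data.List.Relation.Unary.All using (All; []; _∷_)
open import Data.List.Relation.Unary.All.Properties using (map⁺; tabulate⁺)
open import Data.List.Relation.Unary.Any using (satisfied)
open import Data.List.Relation.Unary.Any.Properties using (any⁺; any⁻)
import Data.Integer as ℤ
import Data.Integer.Properties as ℤP
import Data.Rational as ℚ
import Data.Rational.Properties as ℚP
import Data.Rational.Unnormalised as ℚᵘ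
import Data.Rational.Unnormalised.Properties as ℚᵘP
open import Function using (_∘_)
open import Function.Bundles using (Equivalence)
open import Relation.Nullary using (Dec; yes; no; ¬_; contradiction)
open import Relation.Nullary.Decidable using (_×-dec_; toWitness; fromWitness)
open import Relation.Unary using (Decidable)
open import Relation.Binary.PropositionalEquality as ≡ hiding (sym)
open import Algebra.Properties.Semiring.Sum +-*-semiring
  using (∑-distrib-+; ∑-comm; *-distribˡ-sum; sum-cong-≗; sum-replicate-zero) renaming (sum to ∑)

private variable
  P Q R : Set

χ : Dec P → ℕ
χ (yes _) = 1
χ (no _)  = 0

χ≤1 : (p? : Dec P) → χ p? ≤ 1
χ≤1 (yes _) = ≤-refl
χ≤1 (no _)  = z≤n

χ-yes : P → (p? : Dec P) → χ p? ≡ 1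
χ-yes p (yes _) = refl
χ-yes p (no ¬p) = contradiction p ¬p

χ-no : ¬ P → (p? : Dec P) → χ p? ≡ 0
χ-no ¬p (yes p) = contradiction p ¬p
χ-no ¬p (no _)  = refl

χ-witness : (p? : Dec P) → 0 < χ p? → P
χ-witness (yes p) _ = p

χ-mono : (p? : Dec P) (q? : Dec Q) → (P → Q) → χ p? ≤ χ q?
χ-mono (yes p) q? p⇒q = ≤-reflexive (≡.sym (χ-yes (p⇒q p) q?))
χ-mono (no _)  q? p⇒q = z≤n

χ-× : (p? : Dec P) (q? : Dec Q) → χ (p? ×-dec q?) ≡ χ p? * χ q?
χ-× (yes _) (yes _) = refl
χ-× (yes _) (no _)  = refl
χ-× (no _)  _       = refl

χ*χ≡χ : (p? : Dec P) → χ p? * χ p? ≡ χ p?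
χ*χ≡χ (yes _) = refl
χ*χ≡χ (no _)  = refl

χ-complement : (p? : Dec P) (q? : Dec Q) → (P → ¬ Q) → (¬ P → Q) → χ p? + χ q? ≡ 1
χ-complement (yes p) (yes q) p⇒¬q ¬p⇒q = contradiction q (p⇒¬q p)
χ-complement (yes _) (no _)  p⇒¬q ¬p⇒q = refl
χ-complement (no _)  (yes _) p⇒¬q ¬p⇒q = refl
χ-complement (no ¬p) (no ¬q) p⇒¬q ¬p⇒q = contradiction (¬p⇒q ¬p) ¬q

χ-disjoint : (p? : Dec P) (q? : Dec Q) (r? : Dec R) →
             (P → R) → (Q → R) → (P → ¬ Q) → χ p? + χ q? ≤ χ r?
χ-disjoint (yes p) (yes q) r? p⇒r q⇒r p⇒¬q = contradiction q (p⇒¬q p)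
χ-disjoint (yes p) (no _)  r? p⇒r q⇒r p⇒¬q = ≤-reflexive (≡.sym (χ-yes (p⇒r p) r?))
χ-disjoint (no _)  (yes q) r? p⇒r q⇒r p⇒¬q = ≤-reflexive (≡.sym (χ-yes (q⇒r q) r?))
χ-disjoint (no _)  (no _)  r? p⇒r q⇒r p⇒¬q = z≤n

∑-mono-≤ : ∀ {n} {f g : Fin n → ℕ} → (∀ i → f i ≤ g i) → ∑ f ≤ ∑ g
∑-mono-≤ {zero}  f≤g = z≤n
∑-mono-≤ {suc n} f≤g = +-mono-≤ (f≤g zero) (∑-mono-≤ (f≤g ∘ suc))

∑-const : ∀ n c → ∑ {n} (λ _ → c) ≡ n * c
∑-const zero    c = refl
∑-const (suc n) c = cong (c +_) (∑-const n c)

∑-point : ∀ {n} (f : Fin n → ℕ) i → f i ≤ ∑ f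
∑-point f zero    = m≤m+n _ _
∑-point f (suc i) = ≤-trans (∑-point (f ∘ suc) i) (m≤n+m _ (f zero))

∑-pos : ∀ {n} (f : Fin n → ℕ) → 0 < ∑ f → ∃ λ i → 0 < f i
∑-pos {suc n} f ∑f>0 with f zero in eq
... | suc _ = zero , subst (0 <_) (≡.sym eq) z<s
... | zero  with i , fi>0 ← ∑-pos (f ∘ suc) ∑f>0 = suc i , fi>0

∑-single : ∀ {n} (f : Fin n → ℕ) i → (∀ j → j ≢ i → f j ≡ 0) → ∑ f ≡ f i
∑-single {suc n} f zero    f≡0 = trans (cong (f zero +_) rest≡0) (+-identityʳ _)
  where
  rest≡0 : ∑ (f ∘ suc) ≡ 0
  rest≡0 = trans (sum-cong-≗ (λ j → f≡0 (suc j) λ ())) (sum-replicate-zero n)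
∑-single {suc n} f (suc i) f≡0 =
  trans (cong (_+ ∑ (f ∘ suc)) (f≡0 zero λ ()))
        (∑-single (f ∘ suc) i (λ j j≢i → f≡0 (suc j) (j≢i ∘ suc-injective)))

∑∑-even : ∀ {n} (s : Fin n → Fin n → ℕ) → (∀ i j → s i j ≡ s j i) → (∀ i → s i i ≡ 0) →
          ∃ λ k → ∑ (λ i → ∑ (s i)) ≡ k + k
∑∑-even {zero}  s s-sym s-diag = 0 , refl
∑∑-even {suc n} s s-sym s-diag
  with k , eq ← ∑∑-even (λ i j → s (suc i) (suc j)) (λ i j → s-sym (suc i) (suc j)) (s-diag ∘ suc)
  = r + k , (begin
    s zero zero + r + ∑ (λ i → s (suc i) zero + ∑ (λ j → s (suc i) (suc j)))
      ≡⟨ cong₂ _+_ (cong (_+ r) (s-diag zero)) (∑-distrib-+ (λ i → s (suc i) zero) _) ⟩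
    r + (∑ (λ i → s (suc i) zero) + ∑ (λ i → ∑ (λ j → s (suc i) (suc j))))
      ≡⟨ cong₂ (λ a b → r + (a + b)) (sum-cong-≗ (λ i → s-sym (suc i) zero)) eq ⟩
    r + (r + (k + k))
      ≡⟨ regroup r k ⟩
    r + k + (r + k) ∎)
  where
  open ≡-Reasoning
  r : ℕ
  r = ∑ (λ j → s zero (suc j))
  regroup : ∀ a b → a + (a + (b + b)) ≡ a + b + (a + b)
  regroup = solve-∀

length-filter-tabulate : ∀ {m} {A : Set} {P : A → Set} (P? : Decidable P) (g : Fin m → A) →
                         length (filter P? (tabulate g)) ≡ ∑ (λ i → χ (P? (g i)))
length-filter-tabulate {zero}  P? g = refl
length-filter-tabulate {suc m} P? g with P? (g zero)
... | yes _ = cong suc (length-filter-tabulate P? (g ∘ suc))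
... | no _  = length-filter-tabulate P? (g ∘ suc)

sum-map-tabulate : ∀ {m} {A : Set} (g : Fin m → A) (h : A → ℕ) → sum (map h (tabulate g)) ≡ ∑ (h ∘ g)
sum-map-tabulate {zero}  g h = refl
sum-map-tabulate {suc m} g h = cong (h (g zero) +_) (sum-map-tabulate (g ∘ suc) h)

module _ {n : ℕ} where

  count : {P : Fin n → Set} → Decidable P → ℕ
  count P? = ∑ (λ i → χ (P? i))

  module _ {P : Fin n → Set} (P? : Decidable P) where

    count≤n : count P? ≤ n
    count≤n = begin
      count P?           ≤⟨ ∑-mono-≤ (λ i → χ≤1 (P? i)) ⟩
      ∑ {n} (λ _ → 1)    ≡⟨ ∑-const n 1 ⟩
      n * 1              ≡⟨ *-identityʳ n ⟩
      n                  ∎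
      where open ≤-Reasoning

    count-pos : ∀ i → P i → 0 < count P?
    count-pos i p = ≤-trans (≤-reflexive (≡.sym (χ-yes p (P? i)))) (∑-point (λ j → χ (P? j)) i)

    count-witness : 0 < count P? → ∃ P
    count-witness count>0 with i , χ>0 ← ∑-pos (λ j → χ (P? j)) count>0 = i , χ-witness (P? i) χ>0

    count≤1 : (∀ i j → P i → P j → i ≡ j) → count P? ≤ 1
    count≤1 unique with 0 <? count P?
    ... | no  empty    = ≤-trans (≮⇒≥ empty) z≤n
    ... | yes nonempty with i , pi ← count-witness nonempty = begin
      count P?   ≡⟨ ∑-single (λ j → χ (P? j)) i others ⟩
      χ (P? i)   ≤⟨ χ≤1 (P? i) ⟩
      1          ∎
      where
      open ≤-Reasoning
      others : ∀ j → j ≢ i → χ (P? j) ≡ 0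
      others j j≢i = χ-no (λ pj → j≢i (unique j i pj pi)) (P? j)

    count-mono : ∀ {Q} (Q? : Decidable Q) → (∀ i → P i → Q i) → count P? ≤ count Q?
    count-mono Q? P⊆Q = ∑-mono-≤ λ i → χ-mono (P? i) (Q? i) (P⊆Q i)

    count-disjoint : ∀ {Q R} (Q? : Decidable Q) (R? : Decidable R) →
                     (∀ i → P i → R i) → (∀ i → Q i → R i) → (∀ i → P i → ¬ Q i) →
                     count P? + count Q? ≤ count R?
    count-disjoint Q? R? P⊆R Q⊆R P∩Q=∅ = begin
      count P? + count Q?             ≡⟨ ∑-distrib-+ (λ i → χ (P? i)) (λ i → χ (Q? i)) ⟨
      ∑ (λ i → χ (P? i) + χ (Q? i))   ≤⟨ ∑-mono-≤ disjoint ⟩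
      count R?                        ∎
      where
      open ≤-Reasoning
      disjoint : ∀ i → χ (P? i) + χ (Q? i) ≤ χ (R? i)
      disjoint i = χ-disjoint (P? i) (Q? i) (R? i) (P⊆R i) (Q⊆R i) (P∩Q=∅ i)

    count-complement : ∀ {Q} (Q? : Decidable Q) → (∀ i → P i → ¬ Q i) → (∀ i → ¬ P i → Q i) →
                       count P? + count Q? ≡ n
    count-complement Q? P∩Q=∅ P∪Q=all = begin
      count P? + count Q?             ≡⟨ ∑-distrib-+ (λ i → χ (P? i)) (λ i → χ (Q? i)) ⟨
      ∑ (λ i → χ (P? i) + χ (Q? i))   ≡⟨ sum-cong-≗ complement ⟩
      ∑ {n} (λ _ → 1)                 ≡⟨ ∑-const n 1 ⟩
      n * 1                           ≡⟨ *-identityʳ n ⟩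
      n                               ∎
      where
      open ≡-Reasoning
      complement : ∀ i → χ (P? i) + χ (Q? i) ≡ 1
      complement i = χ-complement (P? i) (Q? i) (P∩Q=∅ i) (P∪Q=all i)

  count-≡ : ∀ i → count (_≟ i) ≡ 1
  count-≡ i = trans (∑-single (λ j → χ (j ≟ i)) i (λ j j≢i → χ-no j≢i (j ≟ i))) (χ-yes refl (i ≟ i))

∑< : ℕ → (ℕ → ℕ) → ℕ
∑< zero    f = 0
∑< (suc T) f = ∑< T f + f T

∑<-+ : ∀ a b (f : ℕ → ℕ) → ∑< (a + b) f ≡ ∑< a f + ∑< b (λ i → f (a + i))
∑<-+ a zero    f = trans (cong (λ x → ∑< x f) (+-identityʳ a)) (≡.sym (+-identityʳ _))
∑<-+ a (suc b) f = begin
  ∑< (a + suc b) f                                ≡⟨ cong (λ x → ∑< x f) (+-suc a b) ⟩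
  ∑< (a + b) f + f (a + b)                        ≡⟨ cong (_+ f (a + b)) (∑<-+ a b f) ⟩
  ∑< a f + ∑< b (λ i → f (a + i)) + f (a + b)     ≡⟨ +-assoc (∑< a f) _ _ ⟩
  ∑< a f + (∑< b (λ i → f (a + i)) + f (a + b))   ∎
  where open ≡-Reasoning

∑<-∑ : ∀ {n} T (g : Fin n → ℕ → ℕ) → ∑< T (λ t → ∑ (λ i → g i t)) ≡ ∑ (λ i → ∑< T (g i))
∑<-∑ {n} zero    g = ≡.sym (sum-replicate-zero n)
∑<-∑     (suc T) g = trans (cong (_+ ∑ (λ i → g i T)) (∑<-∑ T g))
                           (≡.sym (∑-distrib-+ (λ i → ∑< T (g i)) (λ i → g i T)))

∑<-χ< : ∀ T x → ∑< T (λ t → χ (t <? x)) ≡ T ⊓ x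
∑<-χ< zero    x = refl
∑<-χ< (suc T) x with T <? x
... | yes T<x = begin
  ∑< T (λ t → χ (t <? x)) + 1   ≡⟨ cong (_+ 1) (∑<-χ< T x) ⟩
  T ⊓ x + 1                     ≡⟨ cong (_+ 1) (m≤n⇒m⊓n≡m (<⇒≤ T<x)) ⟩
  T + 1                         ≡⟨ +-comm T 1 ⟩
  suc T                         ≡⟨ m≤n⇒m⊓n≡m T<x ⟨
  suc T ⊓ x                     ∎
  where open ≡-Reasoning
... | no T≮x = begin
  ∑< T (λ t → χ (t <? x)) + 0   ≡⟨ +-identityʳ _ ⟩
  ∑< T (λ t → χ (t <? x))       ≡⟨ ∑<-χ< T x ⟩
  T ⊓ x                         ≡⟨ m≥n⇒m⊓n≡n (≮⇒≥ T≮x) ⟩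
  x                             ≡⟨ m≥n⇒m⊓n≡n (≤-trans (≮⇒≥ T≮x) (n≤1+n T)) ⟨
  suc T ⊓ x                     ∎
  where open ≡-Reasoning

∑<-bound : ∀ k (g : ℕ → ℕ) b m → (∀ i → i < k → g i + b ≤ m) → ∑< k g + k * b ≤ k * m
∑<-bound zero    g b m bound = z≤n
∑<-bound (suc k) g b m bound = begin
  ∑< k g + g k + (b + k * b)   ≡⟨ regroup (∑< k g) (g k) b (k * b) ⟩
  ∑< k g + k * b + (g k + b)   ≤⟨ +-mono-≤ (∑<-bound k g b m (λ i i<k → bound i (m<n⇒m<1+n i<k)))
                                            (bound k ≤-refl) ⟩
  k * m + m                    ≡⟨ +-comm (k * m) m ⟩
  m + k * m                    ∎
  where
  open ≤-Reasoning
  regroup : ∀ a b c d → a + b + (c + d) ≡ a + d + (b + c)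
  regroup = solve-∀

remoteness-arithmetic : ∀ S N q D → 2 * S + (4 + 5 * D * (q * suc q)) ≤ 2 * ((2 + q * 5) * suc N) →
                        suc N < suc q * D → 2 * S ≤ N * (q * 5 + 4)
remoteness-arithmetic S N q D blocks n<[1+q]*D = +-cancelʳ-≤ deficit (2 * S) _ (begin
  2 * S + deficit                             ≤⟨ blocks ⟩
  2 * ((2 + q * 5) * suc N)                   ≡⟨ expand N q ⟩
  N * (q * 5 + 4) + 4 + q * 5 * (2 + N)       ≤⟨ +-monoʳ-≤ (N * (q * 5 + 4) + 4) (*-monoʳ-≤ (q * 5) n<[1+q]*D) ⟩
  N * (q * 5 + 4) + 4 + q * 5 * (suc q * D)   ≡⟨ regroup N q D ⟩
  N * (q * 5 + 4) + deficit                   ∎)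
  where
  open ≤-Reasoning
  deficit : ℕ
  deficit = 4 + 5 * D * (q * suc q)
  expand : ∀ N q → 2 * ((2 + q * 5) * suc N) ≡ N * (q * 5 + 4) + 4 + q * 5 * (2 + N)
  expand = solve-∀
  regroup : ∀ N q D → N * (q * 5 + 4) + 4 + q * 5 * (suc q * D) ≡ N * (q * 5 + 4) + (4 + 5 * D * (q * suc q))
  regroup = solve-∀

module Levels {n : ℕ} (f : Fin n → ℕ) where

  below? : ∀ t → Decidable (λ i → f i < t)
  below? t i = f i <? t

  above? : ∀ t → Decidable (λ i → t < f i)
  above? t i = t <? f i

  Near : ℕ → Fin n → Set
  Near c i = c ≤ 2 + f i × f i ≤ 2 + c

  near? : ∀ c → Decidable (Near c)
  near? c i = c ≤? 2 + f i ×-dec f i ≤? 2 + c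

  count< count> window : ℕ → ℕ
  count< t = count (below? t)
  count> t = count (above? t)
  window c = count (near? c)

  count>+count< : ∀ t → count> t + count< (suc t) ≡ n
  count>+count< t = count-complement (above? t) (below? (suc t))
    (λ i t<fi fi≤t → <⇒≱ t<fi (s≤s⁻¹ fi≤t)) (λ i t≮fi → s≤s (≮⇒≥ t≮fi))

  ∑≡∑<count> : ∀ T → (∀ i → f i ≤ T) → ∑ f ≡ ∑< T count>
  ∑≡∑<count> T f≤T = begin
    ∑ f                                   ≡⟨ sum-cong-≗ layers ⟩
    ∑ (λ i → ∑< T (λ t → χ (t <? f i)))   ≡⟨ ∑<-∑ T (λ i t → χ (t <? f i)) ⟨
    ∑< T count>                           ∎
    where
    open ≡-Reasoning
    layers : ∀ i → f i ≡ ∑< T (λ t → χ (t <? f i))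
    layers i = ≡.sym (trans (∑<-χ< T (f i)) (m≥n⇒m⊓n≡n (f≤T i)))

  module _ (D : ℕ) .{{_ : NonZero D}} (windows : ∀ c i → c ≤ f i → D ≤ window c) where

    stacked-windows : ∀ j r i → j * 5 + r ≤ f i → suc j * D ≤ count< (3 + (j * 5 + r))
    stacked-windows zero r i r≤fi = begin
      D + 0 * D        ≡⟨ +-identityʳ D ⟩
      D                ≤⟨ windows r i r≤fi ⟩
      window r         ≤⟨ count-mono (near? r) (below? (3 + r)) (λ _ → s≤s ∘ proj₂) ⟩
      count< (3 + r)   ∎
      where open ≤-Reasoning
    stacked-windows (suc j) r i c+5≤fi = begin
      D + suc j * D                     ≤⟨ +-mono-≤ (windows (5 + c) i c+5≤fi)
                                                    (stacked-windows j r i (≤-trans (m≤n+m c 5) c+5≤fi)) ⟩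
      window (5 + c) + count< (3 + c)   ≡⟨ +-comm (window (5 + c)) _ ⟩
      count< (3 + c) + window (5 + c)   ≤⟨ count-disjoint (below? (3 + c)) (near? (5 + c)) (below? (8 + c))
                                                          below⇒below near⇒below below⇒far ⟩
      count< (8 + c)                    ∎
      where
      open ≤-Reasoning
      c : ℕ
      c = j * 5 + r
      below⇒below : ∀ k → f k < 3 + c → f k < 8 + c
      below⇒below k fk<3+c = ≤-trans fk<3+c (m≤n+m (3 + c) 5)
      near⇒below : ∀ k → Near (5 + c) k → f k < 8 + c
      near⇒below k = s≤s ∘ proj₂
      below⇒far : ∀ k → f k < 3 + c → ¬ Near (5 + c) k
      below⇒far k fk<3+c near = ≤⇒≯ (proj₁ near) (+-monoʳ-≤ 2 fk<3+c)

    q : ℕ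
    q = n / D

    n<[1+q]*D : n < suc q * D
    n<[1+q]*D = begin-strict
      n                ≡⟨ m≡m%n+[m/n]*n n D ⟩
      n % D + q * D    <⟨ +-monoˡ-< (q * D) (m%n<n n D) ⟩
      D + q * D        ∎
      where open ≤-Reasoning

    f<q*5 : ∀ i → f i < q * 5
    f<q*5 i = ≰⇒> λ q*5≤fi → <⇒≱ n<[1+q]*D (begin
      suc q * D               ≤⟨ stacked-windows q 0 i (≤-trans (≤-reflexive (+-identityʳ _)) q*5≤fi) ⟩
      count< (3 + (q * 5 + 0)) ≤⟨ count≤n _ ⟩
      n                       ∎)
      where open ≤-Reasoning

    count>-block : ∀ j r → suc j ≤ q → count> (2 + (j * 5 + r)) + suc j * D ≤ n
    count>-block j r 1+j≤q with 0 <? count> (2 + (j * 5 + r))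
    ... | no empty = begin
      count> (2 + (j * 5 + r)) + suc j * D   ≡⟨ cong (_+ suc j * D) (n≤0⇒n≡0 (≮⇒≥ empty)) ⟩
      suc j * D                              ≤⟨ *-monoˡ-≤ D 1+j≤q ⟩
      q * D                                  ≤⟨ m/n*n≤m n D ⟩
      n                                      ∎
      where open ≤-Reasoning
    ... | yes nonempty with i , 2+c<fi ← count-witness (above? (2 + (j * 5 + r))) nonempty = begin
      count> (2 + c) + suc j * D        ≤⟨ +-monoʳ-≤ (count> (2 + c)) (stacked-windows j r i c≤fi) ⟩
      count> (2 + c) + count< (3 + c)   ≡⟨ count>+count< (2 + c) ⟩
      n                                 ∎
      where
      open ≤-Reasoning
      c : ℕ
      c = j * 5 + r
      c≤fi : c ≤ f i
      c≤fi = ≤-trans (m≤n+m c 2) (<⇒≤ 2+c<fi)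

    module _ (v : Fin n) (fv≡0 : f v ≡ 0) where

      count>-initial : ∀ t → count> t + 1 ≤ n
      count>-initial t = begin
        count> t + 1                ≤⟨ +-monoʳ-≤ (count> t) (count-pos (below? (suc t)) v fv<1+t) ⟩
        count> t + count< (suc t)   ≡⟨ count>+count< t ⟩
        n                           ∎
        where
        open ≤-Reasoning
        fv<1+t : f v < suc t
        fv<1+t = subst (_< suc t) (≡.sym fv≡0) z<s

      -- Doubled to avoid the factor 5/2: the levels 2 + j * 5 + r with r < 5 each contribute at
      -- most n − (j + 1)D, and 4 + 5D·j(j + 1) = 2(2 + 5D(1 + ⋯ + j)).
      blocks : ∀ j → j ≤ q → 2 * ∑< (2 + j * 5) count> + (4 + 5 * D * (j * suc j)) ≤ 2 * ((2 + j * 5) * n)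
      blocks zero _ = begin
        2 * ∑< 2 count> + (4 + 5 * D * 0)   ≡⟨ regroup (∑< 2 count>) D ⟩
        2 * (∑< 2 count> + 2 * 1)           ≤⟨ *-monoʳ-≤ 2 (∑<-bound 2 count> 1 n (λ t _ → count>-initial t)) ⟩
        2 * (2 * n)                         ∎
        where
        open ≤-Reasoning
        regroup : ∀ S D → 2 * S + (4 + 5 * D * 0) ≡ 2 * (S + 2 * 1)
        regroup = solve-∀
      blocks (suc j) 1+j≤q = begin
        2 * ∑< (2 + suc j * 5) count> + (4 + 5 * D * (suc j * suc (suc j)))
          ≡⟨ cong (λ S → 2 * S + (4 + 5 * D * (suc j * suc (suc j)))) split ⟩
        2 * (∑< (2 + j * 5) count> + B) + (4 + 5 * D * (suc j * suc (suc j)))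
          ≡⟨ regroup (∑< (2 + j * 5) count>) B j D ⟩
        2 * ∑< (2 + j * 5) count> + (4 + 5 * D * (j * suc j)) + 2 * (B + 5 * (suc j * D))
          ≤⟨ +-mono-≤ (blocks j (<⇒≤ 1+j≤q)) (*-monoʳ-≤ 2 (∑<-bound 5 (λ r → count> (2 + j * 5 + r)) (suc j * D) n
                                                                     (λ r _ → count>-block j r 1+j≤q))) ⟩
        2 * ((2 + j * 5) * n) + 2 * (5 * n)
          ≡⟨ collect j n ⟩
        2 * ((2 + suc j * 5) * n)
          ∎
        where
        open ≤-Reasoning
        B : ℕ
        B = ∑< 5 (λ r → count> (2 + j * 5 + r))
        split : ∑< (2 + suc j * 5) count> ≡ ∑< (2 + j * 5) count> + B
        split = trans (cong (λ T → ∑< (2 + T) count>) (+-comm 5 (j * 5))) (∑<-+ (2 + j * 5) 5 count>)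
        regroup : ∀ S B j D → 2 * (S + B) + (4 + 5 * D * (suc j * suc (suc j)))
                            ≡ 2 * S + (4 + 5 * D * (j * suc j)) + 2 * (B + 5 * (suc j * D))
        regroup = solve-∀
        collect : ∀ j n → 2 * ((2 + j * 5) * n) + 2 * (5 * n) ≡ 2 * ((2 + suc j * 5) * n)
        collect = solve-∀

      ∑-bound : 2 * ∑ f ≤ (n ∸ 1) * (q * 5 + 4)
      ∑-bound = remoteness-arithmetic (∑ f) (n ∸ 1) q D
        (subst (λ m → 2 * ∑ f + (4 + 5 * D * (q * suc q)) ≤ 2 * ((2 + q * 5) * m)) n≡1+[n∸1] all-blocks)
        (subst (_< suc q * D) n≡1+[n∸1] n<[1+q]*D)
        where
        n≡1+[n∸1] : n ≡ suc (n ∸ 1)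
        n≡1+[n∸1] = ≡.sym (m+[n∸m]≡n (≤-trans (s≤s z≤n) (toℕ<n v)))
        all-blocks : 2 * ∑ f + (4 + 5 * D * (q * suc q)) ≤ 2 * ((2 + q * 5) * n)
        all-blocks = subst (λ S → 2 * S + (4 + 5 * D * (q * suc q)) ≤ 2 * ((2 + q * 5) * n))
          (≡.sym (∑≡∑<count> (2 + q * 5) (λ i → ≤-trans (<⇒≤ (f<q*5 i)) (m≤n+m _ 2))))
          (blocks q ≤-refl)

data Within₂ {n : ℕ} (G : Graph n) (x : Fin n) : Fin n → Set where
  here     : Within₂ G x x
  adjacent : ∀ {y} → T (adj G x y) → Within₂ G x y
  common   : ∀ {u y} → T (adj G x u) → T (adj G u y) → Within₂ G x y

adj-sym : ∀ {n} (G : Graph n) {u w} → T (adj G u w) → T (adj G w u)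
adj-sym G {u} {w} = subst T (Graph.sym G u w)

within₂-sym : ∀ {n} {G : Graph n} {x y} → Within₂ G x y → Within₂ G y x
within₂-sym         here           = here
within₂-sym {G = G} (adjacent xy)  = adjacent (adj-sym G xy)
within₂-sym {G = G} (common xu uy) = common (adj-sym G uy) (adj-sym G xu)

module Distance {n : ℕ} (G : Graph n) where

  reach-refl : ∀ k u → T (reach G k u u)
  reach-refl zero    u = fromWitness refl
  reach-refl (suc k) u = Equivalence.from T-∨ (inj₁ (reach-refl k u))

  reach-step : ∀ k u w v → T (adj G u w) → T (reach G k w v) → T (reach G (suc k) u v)
  reach-step k u w v uw wv =
    Equivalence.from T-∨ (inj₂ (any⁺ _ (lose (∈-allFin w) (Equivalence.from T-∧ (uw , wv)))))

  reach-suc⁻ : ∀ k u v → T (reach G (suc k) u v) →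
               T (reach G k u v) ⊎ ∃ λ w → T (adj G u w) × T (reach G k w v)
  reach-suc⁻ k u v r with Equivalence.to T-∨ r
  ... | inj₁ uv  = inj₁ uv
  ... | inj₂ any with w , uwv ← satisfied (any⁻ _ (allFin n) any) = inj₂ (w , Equivalence.to T-∧ uwv)

  reach-snoc : ∀ k u w v → T (reach G k u w) → T (adj G w v) → T (reach G (suc k) u v)
  reach-snoc zero    u w v uw wv with refl ← toWitness uw = reach-step 0 u v v wv (reach-refl 0 v)
  reach-snoc (suc k) u w v uw wv with reach-suc⁻ k u w uw
  ... | inj₁ uw′           = Equivalence.from T-∨ (inj₁ (reach-snoc k u w v uw′ wv))
  ... | inj₂ (x , ux , xw) = reach-step (suc k) u x v ux (reach-snoc k x w v xw wv)

  distFrom-≤ : ∀ k m u v → distFrom G k m u v ≤ k + m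
  distFrom-≤ k zero    u v = m≤m+n k 0
  distFrom-≤ k (suc m) u v with reach G k u v
  ... | true  = m≤m+n k (suc m)
  ... | false = ≤-trans (distFrom-≤ (suc k) m u v) (≤-reflexive (≡.sym (+-suc k m)))

  distFrom-reach : ∀ k m u v → T (reach G (distFrom G k m u v) u v) ⊎ distFrom G k m u v ≡ k + m
  distFrom-reach k zero    u v = inj₂ (≡.sym (+-identityʳ k))
  distFrom-reach k (suc m) u v with reach G k u v in eq
  ... | true  = inj₁ (subst T (≡.sym eq) _)
  ... | false with distFrom-reach (suc k) m u v
  ...   | inj₁ r   = inj₁ r
  ...   | inj₂ eq′ = inj₂ (trans eq′ (≡.sym (+-suc k m)))

  distFrom-least : ∀ k m j u v → k ≤ j → T (reach G j u v) → distFrom G k m u v ≤ j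
  distFrom-least k zero    j u v k≤j r = k≤j
  distFrom-least k (suc m) j u v k≤j r with reach G k u v in eq
  ... | true  = k≤j
  ... | false = distFrom-least (suc k) m j u v (≤∧≢⇒< k≤j k≢j) r
    where
    k≢j : k ≢ j
    k≢j refl = subst T eq r

  dist≤n : ∀ u v → dist G u v ≤ n
  dist≤n u v = distFrom-≤ 0 n u v

  dist-least : ∀ j u v → T (reach G j u v) → dist G u v ≤ j
  dist-least j u v = distFrom-least 0 n j u v z≤n

  dist-self : ∀ u → dist G u u ≡ 0
  dist-self u = n≤0⇒n≡0 (dist-least 0 u u (reach-refl 0 u))

  dist-edge : ∀ v x y → T (adj G x y) → dist G v y ≤ suc (dist G v x)
  dist-edge v x y xy with distFrom-reach 0 n v x
  ... | inj₁ r     = dist-least _ v y (reach-snoc (dist G v x) v x y r xy)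
  ... | inj₂ dvx≡n = ≤-trans (dist≤n v y) (≤-trans (≤-reflexive (≡.sym dvx≡n)) (n≤1+n _))

  dist-within₂ : ∀ v {x y} → Within₂ G x y → dist G v y ≤ 2 + dist G v x
  dist-within₂ v {x} here               = m≤n+m (dist G v x) 2
  dist-within₂ v {x} (adjacent xy)      = ≤-trans (dist-edge v x _ xy) (n≤1+n _)
  dist-within₂ v {x} (common {u} xu uy) = ≤-trans (dist-edge v u _ uy) (s≤s (dist-edge v x u xu))

  intermediate-level : ∀ v {x y k} c → Walk G x y k → dist G v x ≤ c → c ≤ dist G v y →
                       ∃ λ z → dist G v z ≡ c
  intermediate-level v {x} c here                   x≤c c≤y = x , ≤-antisym x≤c c≤y
  intermediate-level v {x} c (step {w = w} xw walk) x≤c c≤y with dist G v w ≤? c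
  ... | yes w≤c = intermediate-level v c walk w≤c c≤y
  ... | no  w≰c = x , ≤-antisym x≤c (s≤s⁻¹ (≤-trans (≰⇒> w≰c) (dist-edge v x w xw)))

minBall₂ : ℕ → ℕ
minBall₂ δ = suc (δ * δ ∸ 2 * (δ / 2))

minBall₂-≤ : ∀ δ d k w → 2 ≤ δ → δ ≤ d → k + k ≤ d → δ * d + 1 ≤ w + (k + k) → minBall₂ δ ≤ w
minBall₂-≤ δ@(suc δ′) d k w 2≤δ δ≤d 2k≤d δd+1≤w+2k = begin
  suc (δ * δ ∸ X)    ≡⟨ +-∸-assoc 1 X≤δ² ⟨
  suc (δ * δ) ∸ X    ≤⟨ m≤n+o⇒m∸n≤o (suc (δ * δ)) X 1+δ²≤X+w ⟩
  w                  ∎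
  where
  open ≤-Reasoning
  X : ℕ
  X = 2 * (δ / 2)
  X≤δ² : X ≤ δ * δ
  X≤δ² = ≤-trans (≤-trans (≤-reflexive (*-comm 2 (δ / 2))) (m/n*n≤m δ 2)) (m≤m*n δ δ)
  2k≤X : d ≡ δ → k + k ≤ X
  2k≤X refl = begin
    k + k            ≡⟨ cong (k +_) (+-identityʳ k) ⟨
    2 * k            ≡⟨ cong (2 *_) (m*n/n≡m k 2) ⟨
    2 * (k * 2 / 2)  ≤⟨ *-monoʳ-≤ 2 (/-monoˡ-≤ 2 (≤-trans (≤-reflexive k*2≡k+k) 2k≤d)) ⟩
    X                ∎
    where
    k*2≡k+k : k * 2 ≡ k + k
    k*2≡k+k = trans (*-comm k 2) (cong (k +_) (+-identityʳ k))
  δ²≤w : δ < d → δ * δ ≤ w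
  δ²≤w δ<d = begin
    δ * δ            ≡⟨ square δ′ ⟩
    δ′ * suc δ + 1   ≤⟨ +-monoˡ-≤ 1 (*-monoʳ-≤ δ′ δ<d) ⟩
    δ′ * d + 1       ≤⟨ +-cancelˡ-≤ d _ _ d+δ′d+1≤d+w ⟩
    w                ∎
    where
    square : ∀ x → suc x * suc x ≡ x * suc (suc x) + 1
    square = solve-∀
    d+δ′d+1≤d+w : d + (δ′ * d + 1) ≤ d + w
    d+δ′d+1≤d+w = begin
      d + (δ′ * d + 1)   ≡⟨ +-assoc d (δ′ * d) 1 ⟨
      δ * d + 1          ≤⟨ δd+1≤w+2k ⟩
      w + (k + k)        ≤⟨ +-monoʳ-≤ w 2k≤d ⟩
      w + d              ≡⟨ +-comm w d ⟩
      d + w              ∎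
  1+δ²≤X+w : suc (δ * δ) ≤ X + w
  1+δ²≤X+w with m≤n⇒m<n∨m≡n δ≤d
  ... | inj₂ refl = begin
    suc (δ * δ)      ≡⟨ +-comm 1 (δ * δ) ⟩
    δ * δ + 1        ≤⟨ δd+1≤w+2k ⟩
    w + (k + k)      ≤⟨ +-monoʳ-≤ w (2k≤X refl) ⟩
    w + X            ≡⟨ +-comm w X ⟩
    X + w            ∎
  ... | inj₁ δ<d = +-mono-≤ (≤-trans (m≥n⇒m/n>0 2≤δ) (m≤m+n (δ / 2) _)) (δ²≤w δ<d)

module Ball {n : ℕ} (G : Graph n) where

  adj? : ∀ u w → Dec (T (adj G u w))
  adj? u w = T? (adj G u w)

  A : Fin n → Fin n → ℕ
  A u w = χ (adj? u w)

  A-sym : ∀ u w → A u w ≡ A w u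
  A-sym u w = cong (χ ∘ T?) (Graph.sym G u w)

  A-irrefl : ∀ u → A u u ≡ 0
  A-irrefl u = cong (χ ∘ T?) (loopless G u)

  adj⇒≢ : ∀ {u w} → T (adj G u w) → u ≢ w
  adj⇒≢ {u} uw refl = subst T (loopless G u) uw

  deg≡∑A : ∀ x → deg G x ≡ ∑ (A x)
  deg≡∑A x = length-filter-tabulate (adj? x) (λ w → w)

  codeg : Fin n → Fin n → ℕ
  codeg x y = count (λ u → adj? x u ×-dec adj? u y)

  codeg≡∑ : ∀ x y → codeg x y ≡ ∑ (λ u → A x u * A u y)
  codeg≡∑ x y = sum-cong-≗ (λ u → χ-× (adj? x u) (adj? u y))

  codeg-self : ∀ x → codeg x x ≡ deg G x
  codeg-self x = begin
    codeg x x                 ≡⟨ codeg≡∑ x x ⟩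
    ∑ (λ u → A x u * A u x)   ≡⟨ sum-cong-≗ (λ u → trans (cong (A x u *_) (A-sym u x)) (χ*χ≡χ (adj? x u))) ⟩
    ∑ (A x)                   ≡⟨ deg≡∑A x ⟨
    deg G x                   ∎
    where open ≡-Reasoning

  ∑codeg≥δ*deg : ∀ δ → (∀ u → δ ≤ deg G u) → ∀ x → δ * deg G x ≤ ∑ (codeg x)
  ∑codeg≥δ*deg δ mindeg x = begin
    δ * deg G x                         ≡⟨ cong (δ *_) (deg≡∑A x) ⟩
    δ * ∑ (A x)                         ≡⟨ *-distribˡ-sum δ (A x) ⟩
    ∑ (λ u → δ * A x u)                 ≡⟨ sum-cong-≗ (λ u → *-comm δ (A x u)) ⟩
    ∑ (λ u → A x u * δ)                 ≤⟨ ∑-mono-≤ (λ u → *-monoʳ-≤ (A x u) (mindeg u)) ⟩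
    ∑ (λ u → A x u * deg G u)           ≡⟨ sum-cong-≗ (λ u → cong (A x u *_) (deg≡∑A u)) ⟩
    ∑ (λ u → A x u * ∑ (A u))           ≡⟨ sum-cong-≗ (λ u → *-distribˡ-sum (A x u) (A u)) ⟩
    ∑ (λ u → ∑ (λ y → A x u * A u y))   ≡⟨ ∑-comm (λ u y → A x u * A u y) ⟩
    ∑ (λ y → ∑ (λ u → A x u * A u y))   ≡⟨ sum-cong-≗ (codeg≡∑ x) ⟨
    ∑ (codeg x)                         ∎
    where open ≤-Reasoning

  -- Twice the number of edges inside the neighbourhood of x.
  nbhdDegreeSum : Fin n → ℕ
  nbhdDegreeSum x = ∑ (λ y → A x y * codeg x y)

  nbhdDegreeSum-even : ∀ x → ∃ λ k → nbhdDegreeSum x ≡ k + k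
  nbhdDegreeSum-even x = map₂ (trans as-double-sum) (∑∑-even (λ y u → A x y * (A x u * A u y)) swap diagonal)
    where
    as-double-sum : nbhdDegreeSum x ≡ ∑ (λ y → ∑ (λ u → A x y * (A x u * A u y)))
    as-double-sum = sum-cong-≗ λ y →
      trans (cong (A x y *_) (codeg≡∑ x y)) (*-distribˡ-sum (A x y) (λ u → A x u * A u y))
    left-comm : ∀ a b c → a * (b * c) ≡ b * (a * c)
    left-comm = solve-∀
    swap : ∀ y u → A x y * (A x u * A u y) ≡ A x u * (A x y * A y u)
    swap y u = trans (cong (λ a → A x y * (A x u * a)) (A-sym u y)) (left-comm (A x y) (A x u) (A y u))
    diagonal : ∀ y → A x y * (A x y * A y y) ≡ 0
    diagonal y = begin
      A x y * (A x y * A y y)   ≡⟨ cong (λ a → A x y * (A x y * a)) (A-irrefl y) ⟩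
      A x y * (A x y * 0)       ≡⟨ cong (A x y *_) (*-zeroʳ (A x y)) ⟩
      A x y * 0                 ≡⟨ *-zeroʳ (A x y) ⟩
      0                         ∎
      where open ≡-Reasoning

  module _ (c4 : C4Free G) where

    codeg≤1 : ∀ x y → y ≢ x → codeg x y ≤ 1
    codeg≤1 x y y≢x = count≤1 (λ u → adj? x u ×-dec adj? u y) unique
      where
      unique : ∀ u u′ → T (adj G x u) × T (adj G u y) → T (adj G x u′) × T (adj G u′ y) → u ≡ u′
      unique u u′ (xu , uy) (xu′ , u′y) with u ≟ u′
      ... | yes u≡u′ = u≡u′
      ... | no  u≢u′ = ⊥-elim (c4 x u y u′ (adj⇒≢ xu) (y≢x ∘ ≡.sym) (adj⇒≢ xu′) (adj⇒≢ uy) u≢u′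
                                 (adj⇒≢ (adj-sym G u′y)) xu uy (adj-sym G u′y) (adj-sym G xu′))

    nbhdDegreeSum≤deg : ∀ x → nbhdDegreeSum x ≤ deg G x
    nbhdDegreeSum≤deg x = ≤-trans (∑-mono-≤ term≤A) (≤-reflexive (≡.sym (deg≡∑A x)))
      where
      term≤A : ∀ y → A x y * codeg x y ≤ A x y
      term≤A y with y ≟ x
      ... | yes refl = ≤-trans (≤-reflexive (cong (_* codeg y y) (A-irrefl y))) z≤n
      ... | no  y≢x  = ≤-trans (*-monoʳ-≤ (A x y) (codeg≤1 x y y≢x)) (≤-reflexive (*-identityʳ (A x y)))

    module _ (x : Fin n) (B : Fin n → ℕ) (B≥1 : ∀ y → Within₂ G x y → 1 ≤ B y) where

      codeg≤B : ∀ y → y ≢ x → codeg x y ≤ B y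
      codeg≤B y y≢x with 0 <? codeg x y
      ... | no  empty    = ≤-trans (≮⇒≥ empty) z≤n
      ... | yes nonempty with u , xu , uy ← count-witness (λ u → adj? x u ×-dec adj? u y) nonempty =
        ≤-trans (codeg≤1 x y y≢x) (B≥1 y (common xu uy))

      -- Summed over y this reads ∑ codeg + deg x + 1 ≤ ∑ B + deg x + nbhdDegreeSum x.
      ball-pointwise : ∀ y → codeg x y + A x y + χ (y ≟ x) ≤ B y + deg G x * χ (y ≟ x) + A x y * codeg x y
      ball-pointwise y with y ≟ x
      ... | yes refl = begin
        codeg x x + A x x + 1                   ≡⟨ cong₂ (λ c a → c + a + 1) (codeg-self x) (A-irrefl x) ⟩
        deg G x + 0 + 1                         ≡⟨ regroup (deg G x) (codeg x x) ⟩
        1 + deg G x * 1 + 0 * codeg x x         ≤⟨ +-monoˡ-≤ _ (+-monoˡ-≤ _ (B≥1 x here)) ⟩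
        B x + deg G x * 1 + 0 * codeg x x       ≡⟨ cong (λ a → B x + deg G x * 1 + a * codeg x x) (A-irrefl x) ⟨
        B x + deg G x * 1 + A x x * codeg x x   ∎
        where
        open ≤-Reasoning
        regroup : ∀ d c → d + 0 + 1 ≡ 1 + d * 1 + 0 * c
        regroup = solve-∀
      ... | no y≢x with adj? x y
      ...   | yes xy = begin
        codeg x y + 1 + 0                   ≡⟨ regroup (codeg x y) (deg G x) ⟩
        1 + deg G x * 0 + 1 * codeg x y     ≤⟨ +-monoˡ-≤ _ (+-monoˡ-≤ _ (B≥1 y (adjacent xy))) ⟩
        B y + deg G x * 0 + 1 * codeg x y   ∎
        where
        open ≤-Reasoning
        regroup : ∀ c d → c + 1 + 0 ≡ 1 + d * 0 + 1 * c
        regroup = solve-∀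
      ...   | no _ = begin
        codeg x y + 0 + 0                   ≡⟨ +-identityʳ _ ⟩
        codeg x y + 0                       ≡⟨ +-identityʳ _ ⟩
        codeg x y                           ≤⟨ codeg≤B y y≢x ⟩
        B y                                 ≡⟨ regroup (B y) (deg G x) (codeg x y) ⟩
        B y + deg G x * 0 + 0 * codeg x y   ∎
        where
        open ≤-Reasoning
        regroup : ∀ b d c → b ≡ b + d * 0 + 0 * c
        regroup = solve-∀

      ball-counting : ∀ δ → (∀ u → δ ≤ deg G u) → δ * deg G x + 1 ≤ ∑ B + nbhdDegreeSum x
      ball-counting δ mindeg = +-cancelˡ-≤ d _ _ (begin
        d + (δ * d + 1)
          ≤⟨ +-monoʳ-≤ d (+-monoˡ-≤ 1 (∑codeg≥δ*deg δ mindeg x)) ⟩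
        d + (∑ (codeg x) + 1)
          ≡⟨ regroupˡ d (∑ (codeg x)) ⟩
        ∑ (codeg x) + d + 1
          ≡⟨ cong₂ (λ a b → ∑ (codeg x) + a + b) (deg≡∑A x) (≡.sym (count-≡ x)) ⟩
        ∑ (codeg x) + ∑ (A x) + count (_≟ x)
          ≡⟨ lhs-split ⟨
        ∑ (λ y → codeg x y + A x y + χ (y ≟ x))
          ≤⟨ ∑-mono-≤ ball-pointwise ⟩
        ∑ (λ y → B y + d * χ (y ≟ x) + A x y * codeg x y)
          ≡⟨ rhs-split ⟩
        ∑ B + d * count (_≟ x) + nbhdDegreeSum x
          ≡⟨ cong (λ c → ∑ B + d * c + nbhdDegreeSum x) (count-≡ x) ⟩
        ∑ B + d * 1 + nbhdDegreeSum x
          ≡⟨ regroupʳ (∑ B) d (nbhdDegreeSum x) ⟩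
        d + (∑ B + nbhdDegreeSum x)
          ∎)
        where
        open ≤-Reasoning
        d : ℕ
        d = deg G x
        regroupˡ : ∀ d c → d + (c + 1) ≡ c + d + 1
        regroupˡ = solve-∀
        regroupʳ : ∀ b d e → b + d * 1 + e ≡ d + (b + e)
        regroupʳ = solve-∀
        lhs-split : ∑ (λ y → codeg x y + A x y + χ (y ≟ x)) ≡ ∑ (codeg x) + ∑ (A x) + count (_≟ x)
        lhs-split = trans (∑-distrib-+ (λ y → codeg x y + A x y) (λ y → χ (y ≟ x)))
                          (cong (_+ count (_≟ x)) (∑-distrib-+ (codeg x) (A x)))
        rhs-split : ∑ (λ y → B y + d * χ (y ≟ x) + A x y * codeg x y)
                  ≡ ∑ B + d * count (_≟ x) + nbhdDegreeSum x
        rhs-split = begin-equality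
          ∑ (λ y → B y + d * χ (y ≟ x) + A x y * codeg x y)
            ≡⟨ ∑-distrib-+ (λ y → B y + d * χ (y ≟ x)) (λ y → A x y * codeg x y) ⟩
          ∑ (λ y → B y + d * χ (y ≟ x)) + nbhdDegreeSum x
            ≡⟨ cong (_+ nbhdDegreeSum x) (∑-distrib-+ B (λ y → d * χ (y ≟ x))) ⟩
          ∑ B + ∑ (λ y → d * χ (y ≟ x)) + nbhdDegreeSum x
            ≡⟨ cong (λ c → ∑ B + c + nbhdDegreeSum x) (*-distribˡ-sum d (λ y → χ (y ≟ x))) ⟨
          ∑ B + d * count (_≟ x) + nbhdDegreeSum x
            ∎

      ball-size : ∀ δ → 2 ≤ δ → (∀ u → δ ≤ deg G u) → minBall₂ δ ≤ ∑ B
      ball-size δ 2≤δ mindeg with k , e≡k+k ← nbhdDegreeSum-even x =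
        minBall₂-≤ δ (deg G x) k (∑ B) 2≤δ (mindeg x)
          (subst (_≤ deg G x) e≡k+k (nbhdDegreeSum≤deg x))
          (subst (λ e → δ * deg G x + 1 ≤ ∑ B + e) e≡k+k (ball-counting δ mindeg))

module _ {n : ℕ} (G : Graph n) (connected : Connected G) (c4 : C4Free G)
         (δ : ℕ) (2≤δ : 2 ≤ δ) (mindeg : ∀ u → δ ≤ deg G u) (v : Fin n) where

  open Distance G
  open Levels (dist G v)

  distance-windows : ∀ c i → c ≤ dist G v i → minBall₂ δ ≤ window c
  distance-windows c i c≤dvi
    with x , refl ← intermediate-level v c (proj₂ (connected v i))
                      (≤-trans (≤-reflexive (dist-self v)) z≤n) c≤dvi
    = Ball.ball-size G c4 x (λ y → χ (near? (dist G v x) y)) near δ 2≤δ mindeg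
    where
    near : ∀ y → Within₂ G x y → 1 ≤ χ (near? (dist G v x) y)
    near y xy = ≤-reflexive (≡.sym (χ-yes (dist-within₂ v (within₂-sym xy) , dist-within₂ v xy) (near? _ y)))

  σ-bound : 2 * σ G v ≤ (n ∸ 1) * (n / minBall₂ δ * 5 + 4)
  σ-bound = subst (λ s → 2 * s ≤ (n ∸ 1) * (n / minBall₂ δ * 5 + 4))
                  (≡.sym (sum-map-tabulate (λ i → i) (dist G v)))
                  (∑-bound (minBall₂ δ) distance-windows v (dist-self v))

-- +_ is opened only here: at top level it makes sections such as (c +_) ambiguous.
module _ where
  open ℤ using (+_)

  /-≤-bound : ∀ m s q → 2 * s ≤ suc m * (q * 5 + 4) →
              (+ s) ℚ./ suc m ≤ℚ (+ 5 ℚ./ 2) ℚ.* ((+ q) ℚ./ 1) ℚ.+ (+ 2 ℚ./ 1)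
  /-≤-bound m s q 2s≤[1+m][5q+4] = ℚP.toℚᵘ-cancel-≤ toℚᵘ-≤
    where
    toℚᵘ-/ : ∀ a m → ℚ.toℚᵘ ((+ a) ℚ./ suc m) ℚᵘ.≃ ℚᵘ.mkℚᵘ (+ a) m
    toℚᵘ-/ a m = ℚP.toℚᵘ-fromℚᵘ (ℚᵘ.mkℚᵘ (+ a) m)
    bnd : ℚ.ℚ
    bnd = (+ 5 ℚ./ 2) ℚ.* ((+ q) ℚ./ 1) ℚ.+ (+ 2 ℚ./ 1)
    bndᵘ : ℚᵘ.ℚᵘ
    bndᵘ = ℚᵘ.mkℚᵘ (+ 5) 1 ℚᵘ.* ℚᵘ.mkℚᵘ (+ q) 0 ℚᵘ.+ ℚᵘ.mkℚᵘ (+ 2) 0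
    toℚᵘ-bnd : ℚ.toℚᵘ bnd ℚᵘ.≃ bndᵘ
    toℚᵘ-bnd = ℚᵘP.≃-trans (ℚP.toℚᵘ-homo-+ ((+ 5 ℚ./ 2) ℚ.* ((+ q) ℚ./ 1)) (+ 2 ℚ./ 1))
      (ℚᵘP.+-cong (ℚᵘP.≃-trans (ℚP.toℚᵘ-homo-* (+ 5 ℚ./ 2) ((+ q) ℚ./ 1))
                               (ℚᵘP.*-cong (toℚᵘ-/ 5 1) (toℚᵘ-/ q 0)))
                  (toℚᵘ-/ 2 0))
    cross : + s ℤ.* + 2 ℤ.≤ (+ 5 ℤ.* + q ℤ.* + 1 ℤ.+ + 2 ℤ.* + 2) ℤ.* + suc m
    cross = subst₂ ℤ._≤_ lhs rhs (ℤ.+≤+ 2s≤[1+m][5q+4])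
      where
      open ≡-Reasoning
      regroup : ∀ m q → suc m * (q * 5 + 4) ≡ (5 * q * 1 + 4) * suc m
      regroup = solve-∀
      5q·1 : + (5 * q * 1) ≡ + 5 ℤ.* + q ℤ.* + 1
      5q·1 = trans (ℤP.pos-* (5 * q) 1) (cong (ℤ._* + 1) (ℤP.pos-* 5 q))
      lhs : + (2 * s) ≡ + s ℤ.* + 2
      lhs = trans (cong +_ (*-comm 2 s)) (ℤP.pos-* s 2)
      rhs : + (suc m * (q * 5 + 4)) ≡ (+ 5 ℤ.* + q ℤ.* + 1 ℤ.+ + 2 ℤ.* + 2) ℤ.* + suc m
      rhs = begin
        + (suc m * (q * 5 + 4))                  ≡⟨ cong +_ (regroup m q) ⟩
        + ((5 * q * 1 + 4) * suc m)              ≡⟨ ℤP.pos-* (5 * q * 1 + 4) (suc m) ⟩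
        + (5 * q * 1 + 4) ℤ.* + suc m            ≡⟨ cong (ℤ._* + suc m) (ℤP.pos-+ (5 * q * 1) 4) ⟩
        (+ (5 * q * 1) ℤ.+ + 4) ℤ.* + suc m      ≡⟨ cong (λ a → (a ℤ.+ + 4) ℤ.* + suc m) 5q·1 ⟩
        (+ 5 ℤ.* + q ℤ.* + 1 ℤ.+ + 2 ℤ.* + 2) ℤ.* + suc m ∎
    toℚᵘ-≤ : ℚ.toℚᵘ ((+ s) ℚ./ suc m) ℚᵘ.≤ ℚ.toℚᵘ bnd
    toℚᵘ-≤ = begin
      ℚ.toℚᵘ ((+ s) ℚ./ suc m)   ≃⟨ toℚᵘ-/ s m ⟩
      ℚᵘ.mkℚᵘ (+ s) m            ≤⟨ ℚᵘ.*≤* cross ⟩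
      bndᵘ                       ≃⟨ toℚᵘ-bnd ⟨
      ℚ.toℚᵘ bnd                 ∎
      where open ℚᵘP.≤-Reasoning

  0≤bound : ∀ n δ → ℚ.0ℚ ≤ℚ bound n δ
  0≤bound n δ = /-≤-bound 0 0 (n / minBall₂ δ) z≤n

  avg≤bound : ∀ n δ s → 2 * s ≤ (n ∸ 1) * (n / minBall₂ δ * 5 + 4) → avg s n ≤ℚ bound n δ
  avg≤bound zero          δ s _   = 0≤bound 0 δ
  avg≤bound (suc zero)    δ s _   = 0≤bound 1 δ
  avg≤bound (suc (suc m)) δ s 2s≤ = /-≤-bound m s (suc (suc m) / minBall₂ δ) 2s≤

  ρ-≤ : ∀ {n} (G : Graph n) {b} → ℚ.0ℚ ≤ℚ b → (∀ v → σ̄ G v ≤ℚ b) → ρ G ≤ℚ b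
  ρ-≤ {n} G {b} 0≤b σ̄≤b = foldr-⊔-lub (map (σ̄ G) (allFin n)) (map⁺ (tabulate⁺ σ̄≤b))
    where
    foldr-⊔-lub : ∀ xs → All (_≤ℚ b) xs → foldr ℚ._⊔_ ℚ.0ℚ xs ≤ℚ b
    foldr-⊔-lub []       []           = 0≤b
    foldr-⊔-lub (x ∷ xs) (x≤b ∷ xs≤b) = ℚP.⊔-lub x≤b (foldr-⊔-lub xs xs≤b)

theorem5p5 : (n δ : ℕ) → 3 ≤ δ → (G : Graph n) → Connected G → C4Free G → MinDegree G δ →
    ρ G ≤ℚ bound n δ
theorem5p5 n δ 3≤δ G connected c4 (mindeg , _) = ρ-≤ G (0≤bound n δ) λ v →
  avg≤bound n δ (σ G v) (σ-bound G connected c4 δ (<⇒≤ 3≤δ) mindeg v)
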